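{- Let $m\ge 1$, $1\le j\le m+1$, and let $v=D(v_1,\dots,v_{j-1},v_j,\varnothing,\dots,\varnothing)\in\mathcal D_{m,n}$ with $v_j\neq\varnothing$. Then $v$ can be written in a unique way as $v'*v''$, where $v'$ is of the form $D(v'_1,\dots,v'_{j-1},v'_j10^m,\varnothing,\dots,\varnothing)$ (for some possibly empty $m$-Dyck paths $v'_1,\dots,v'_j$) and $v''$ is prime.
   Context: An $m$-Dyck path of size $n$ is a word with $n$ letters $1$ (up steps $(+m,+m)$) and $mn$ letters $0$ (down steps $(+1,-1)$) whose lattice path from $(0,0)$ never goes strictly below the horizontal axis; $\mathcal D_{m,n}$ is the set of them and $\varnothing$ the empty path. $D(w_1,\dots,w_{m+1})$ denotes $1w_10\,w_20\cdots w_m0\,w_{m+1}$, and juxtaposition denotes concatenation. A contact is a vertex of height $0$ distinct from the endpoints; a non-empty path is prime if it has no contact. For non-empty $w_1,w_2$, $w_1*w_2$ is obtained from $w_1$ by replacing its rightmost peak (last occurrence of $10^m$) by $w_2$. -}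

module Defs where

open import Data.Nat using (ℕ; zero; suc; _*_; _≤_)
open import Data.List using (List; []; _∷_; _++_; replicate; length)
open import Data.Vec using (Vec; []; _∷_)
open import Data.Product using (Σ; ∃; _×_; _,_)
open import Relation.Binary.PropositionalEquality using (_≡_)
open import Relation.Nullary using (¬_)

-- Letters: 𝟙 is an up step (+m,+m), 𝟘 is a down step (+1,-1).
data Letter : Set where
  𝟙 𝟘 : Letter

Word : Set
Word = List Letter

ones : Word → ℕ
ones []       = 0
ones (𝟙 ∷ w) = suc (ones w)
ones (𝟘 ∷ w) = ones w

zeros : Word → ℕ
zeros []       = 0
zeros (𝟙 ∷ w) = zeros w
zeros (𝟘 ∷ w) = suc (zeros w)

-- w ∈ 𝒟_{m,n}: n up steps, m*n down steps, never strictly below the axis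
-- (height of the endpoint of any prefix p is m*ones p - zeros p ≥ 0).
record Dyck (m n : ℕ) (w : Word) : Set where
  field
    upCount   : ones w ≡ n
    downCount : zeros w ≡ m * n
    nonneg    : ∀ p s → w ≡ p ++ s → zeros p ≤ m * ones p

IsDyck : ℕ → Word → Set
IsDyck m w = ∃ λ n → Dyck m n w

-- A contact: a vertex of height 0 distinct from the endpoints.
Contact : ℕ → Word → Set
Contact m w = Σ Word λ p → Σ Word λ s →
  w ≡ p ++ s × ¬ (p ≡ []) × ¬ (s ≡ []) × zeros p ≡ m * ones p

Prime : ℕ → Word → Set
Prime m w = IsDyck m w × ¬ (w ≡ []) × ¬ Contact m w

peak : ℕ → Word
peak m = 𝟙 ∷ replicate m 𝟘

joinZ : ∀ {k} → Vec Word (suc k) → Word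
joinZ (w ∷ [])       = w
joinZ (w ∷ (u ∷ ws)) = w ++ (𝟘 ∷ joinZ (u ∷ ws))

D : ∀ {m} → Vec Word (suc m) → Word
D ws = 𝟙 ∷ joinZ ws

-- Star m w₁ w₂ w : w = w₁ * w₂, i.e. w is obtained from w₁ by replacing
-- its rightmost occurrence of 1 0^m by w₂ (w₁, w₂ non-empty).
Star : ℕ → Word → Word → Word → Set
Star m w₁ w₂ w = ¬ (w₁ ≡ []) × ¬ (w₂ ≡ []) ×
  (Σ Word λ a → Σ Word λ b →
     w₁ ≡ a ++ (peak m ++ b) × w ≡ a ++ (w₂ ++ b) ×
     (∀ a' b' → w₁ ≡ a' ++ (peak m ++ b') → length a' ≤ length a))

-- Cutting the slot v_j = x y at its last prime factor y (x a possibly empty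
-- m-Dyck path) gives the factorisation: v' = D(v_1,…,v_{j-1},x 1 0^m,∅,…,∅)
-- and v'' = y, since the peak 1 0^m at the end of slot j is followed only by
-- down steps and is therefore the rightmost peak of v'. Conversely, in any
-- such factorisation that peak is forced to be the rightmost one, so v
-- is D(v'_1,…,v'_{j-1},v'_j v'',∅,…,∅); as the components of D(…) are
-- recovered from the word (a balanced path followed by a down step dips below
-- the axis), v_j = v'_j v'', and a Dyck path has a unique last prime factor.
module Submission where

open import Defs
open import Data.Nat using (ℕ; zero; suc; _≤_; _<_; _+_; _*_; _∸_; z≤n; s≤s; s≤s⁻¹)
open import Data.Nat.Properties
  using (*-distribˡ-+; *-zeroʳ; +-cancelˡ-≡; +-cancelˡ-≤; +-monoʳ-≤; ≤-refl; ≤-trans; ≤-antisym;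
         ≤-reflexive; m≤m+n; <-irrefl; suc-injective; _≟_)
open import Data.Fin using (Fin; toℕ; zero; suc)
import Data.Fin.Properties as Fin
open import Data.List using (List; []; _∷_; _++_; _∷ʳ_; replicate; length)
open import Data.List.Properties
  using (∷-injective; ∷-injectiveˡ; ∷-injectiveʳ; length-++; ++-identityʳ; ++-assoc;
         ++-cancelˡ; length-++-≤ʳ; ∷ʳ-++)
open import Data.List.Relation.Unary.All using (All; _∷_)
import Data.List.Relation.Unary.All.Properties as All
open import Data.Vec using (Vec; lookup; _[_]≔_; []; _∷_)
open import Data.Vec.Properties using ([]≔-idempotent; []≔-lookup; lookup∘update; lookup∘update′)
open import Data.Product using (Σ; ∃; ∃!; _×_; _,_; proj₁; proj₂)
open import Data.Sum using (_⊎_; inj₁; inj₂)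
open import Data.Empty using (⊥; ⊥-elim)
open import Relation.Binary.PropositionalEquality
  using (_≡_; _≢_; refl; sym; trans; cong; cong₂; subst; subst₂; module ≡-Reasoning)
open import Relation.Nullary using (¬_; Dec; yes; no)
open import Relation.Nullary.Decidable using (_×-dec_)

open ≡-Reasoning

private
  variable
    A : Set
    a b w x y : Word

++-split : ∀ (a b c d : List A) → a ++ b ≡ c ++ d →
  (∃ λ t → c ≡ a ++ t × b ≡ t ++ d) ⊎ (∃ λ t → a ≡ c ++ t × d ≡ t ++ b)
++-split [] b c d eq = inj₁ (c , refl , eq)
++-split (x ∷ a) b [] d eq = inj₂ (x ∷ a , refl , sym eq)
++-split (x ∷ a) b (y ∷ c) d eq with refl , eq′ ← ∷-injective eq with ++-split a b c d eq′
... | inj₁ (t , c≡at , b≡td) = inj₁ (t , cong (x ∷_) c≡at , b≡td)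
... | inj₂ (t , a≡ct , d≡tb) = inj₂ (t , cong (x ∷_) a≡ct , d≡tb)

++-cancel-equalLength : ∀ (a c b d : List A) → a ++ b ≡ c ++ d → length a ≡ length c → a ≡ c × b ≡ d
++-cancel-equalLength [] [] b d eq _ = refl , eq
++-cancel-equalLength (x ∷ a) (y ∷ c) b d eq |a|≡|c|
  with refl , eq′ ← ∷-injective eq
  with refl , b≡d ← ++-cancel-equalLength a c b d eq′ (suc-injective |a|≡|c|) = refl , b≡d

[]≔-append : ∀ {n} (xs : Vec (List A) n) i (x w : List A) →
  (xs [ i ]≔ x) [ i ]≔ (lookup (xs [ i ]≔ x) i ++ w) ≡ xs [ i ]≔ (x ++ w)
[]≔-append xs i x w = begin
  (xs [ i ]≔ x) [ i ]≔ (lookup (xs [ i ]≔ x) i ++ w) ≡⟨ cong (λ z → (xs [ i ]≔ x) [ i ]≔ (z ++ w)) (lookup∘update i xs x) ⟩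
  (xs [ i ]≔ x) [ i ]≔ (x ++ w)                      ≡⟨ []≔-idempotent xs i ⟩
  xs [ i ]≔ (x ++ w)                                 ∎

update-preserves : ∀ {n} (P : A → Set) (xs : Vec A n) i x →
  (∀ k → P (lookup xs k)) → P x → ∀ k → P (lookup (xs [ i ]≔ x) k)
update-preserves P xs i x Pxs Px k with k Fin.≟ i
... | yes refl = subst P (sym (lookup∘update i xs x)) Px
... | no k≢i = subst P (sym (lookup∘update′ k≢i xs x)) (Pxs k)

ones-++ : ∀ a b → ones (a ++ b) ≡ ones a + ones b
ones-++ [] b = refl
ones-++ (𝟙 ∷ a) b = cong suc (ones-++ a b)
ones-++ (𝟘 ∷ a) b = ones-++ a b

zeros-++ : ∀ a b → zeros (a ++ b) ≡ zeros a + zeros b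
zeros-++ [] b = refl
zeros-++ (𝟙 ∷ a) b = zeros-++ a b
zeros-++ (𝟘 ∷ a) b = cong suc (zeros-++ a b)

*-ones-++ : ∀ m a b → m * ones (a ++ b) ≡ m * ones a + m * ones b
*-ones-++ m a b = trans (cong (m *_) (ones-++ a b)) (*-distribˡ-+ m (ones a) (ones b))

Balanced : ℕ → Word → Set
Balanced m w = zeros w ≡ m * ones w

AtOrAbove : ℕ → Word → Set
AtOrAbove m w = zeros w ≤ m * ones w

NonNegative : ℕ → Word → Set
NonNegative m w = ∀ p s → w ≡ p ++ s → AtOrAbove m p

DyckWord : ℕ → Word → Set
DyckWord m w = Balanced m w × NonNegative m w

IsDyck⇒DyckWord : ∀ {m} → IsDyck m w → DyckWord m w
IsDyck⇒DyckWord {m = m} (n , d) = trans (Dyck.downCount d) (cong (m *_) (sym (Dyck.upCount d))) , Dyck.nonneg d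

DyckWord⇒IsDyck : ∀ {m} → DyckWord m w → IsDyck m w
DyckWord⇒IsDyck (bal , nonneg) = _ , record { upCount = refl ; downCount = bal ; nonneg = nonneg }

zeros-++-balanced : ∀ m a b → Balanced m a → zeros (a ++ b) ≡ m * ones a + zeros b
zeros-++-balanced m a b bal = trans (zeros-++ a b) (cong (_+ zeros b) bal)

balanced-++ : ∀ m a b → Balanced m a → Balanced m b → Balanced m (a ++ b)
balanced-++ m a b bal-a bal-b =
  trans (zeros-++-balanced m a b bal-a) (trans (cong (m * ones a +_) bal-b) (sym (*-ones-++ m a b)))

balanced-cancelˡ : ∀ m a b → Balanced m a → Balanced m (a ++ b) → Balanced m b
balanced-cancelˡ m a b bal-a bal-ab =
  +-cancelˡ-≡ (m * ones a) _ _ (trans (sym (zeros-++-balanced m a b bal-a)) (trans bal-ab (*-ones-++ m a b)))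

atOrAbove-++⁺ : ∀ m a b → Balanced m a → AtOrAbove m b → AtOrAbove m (a ++ b)
atOrAbove-++⁺ m a b bal-a ab =
  subst₂ _≤_ (sym (zeros-++-balanced m a b bal-a)) (sym (*-ones-++ m a b)) (+-monoʳ-≤ (m * ones a) ab)

atOrAbove-++⁻ : ∀ m a b → Balanced m a → AtOrAbove m (a ++ b) → AtOrAbove m b
atOrAbove-++⁻ m a b bal-a ab =
  +-cancelˡ-≤ (m * ones a) _ _ (subst₂ _≤_ (zeros-++-balanced m a b bal-a) (*-ones-++ m a b) ab)

balanced-∷ʳ-𝟘-below : ∀ m a → Balanced m a → ¬ AtOrAbove m (a ∷ʳ 𝟘)
balanced-∷ʳ-𝟘-below m a bal ab with () ← subst (1 ≤_) (*-zeroʳ m) (atOrAbove-++⁻ m a (𝟘 ∷ []) bal ab)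

nonNegative-prefix : ∀ m → NonNegative m (a ++ b) → NonNegative m a
nonNegative-prefix {a} {b} m nn p s a≡ps = nn p (s ++ b) (trans (cong (_++ b) a≡ps) (++-assoc p s b))

nonNegative-suffix : ∀ m → Balanced m a → NonNegative m (a ++ b) → NonNegative m b
nonNegative-suffix {a} {b} m bal-a nn p s b≡ps =
  atOrAbove-++⁻ m a p bal-a (nn (a ++ p) s (trans (cong (a ++_) b≡ps) (sym (++-assoc a p s))))

dyck-[] : ∀ m → DyckWord m []
dyck-[] m = sym (*-zeroʳ m) , λ { [] _ _ → z≤n ; (_ ∷ _) _ () }

dyck-++ : ∀ m → DyckWord m a → DyckWord m b → DyckWord m (a ++ b)
dyck-++ {a} {b} m (bal-a , nn-a) (bal-b , nn-b) = balanced-++ m a b bal-a bal-b , nonneg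
  where
  nonneg : NonNegative m (a ++ b)
  nonneg p s eq with ++-split a b p s eq
  ... | inj₁ (t , refl , b≡ts) = atOrAbove-++⁺ m a t bal-a (nn-b t s b≡ts)
  ... | inj₂ (t , a≡pt , _) = nn-a p t a≡pt

dyck-split : ∀ m → Balanced m a → DyckWord m (a ++ b) → DyckWord m a × DyckWord m b
dyck-split {a} {b} m bal-a (bal-ab , nn-ab) =
  (bal-a , nonNegative-prefix m nn-ab) ,
  (balanced-cancelˡ m a b bal-a bal-ab , nonNegative-suffix m bal-a nn-ab)

dyck-𝟘-cancel : ∀ m → DyckWord m x → DyckWord m y → x ++ 𝟘 ∷ a ≡ y ++ 𝟘 ∷ b → x ≡ y × a ≡ b
dyck-𝟘-cancel {x} {y} {a} {b} m (bal-x , nn-x) (bal-y , nn-y) eq with ++-split x (𝟘 ∷ a) y (𝟘 ∷ b) eq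
... | inj₁ ([] , y≡x , e) = sym (trans y≡x (++-identityʳ x)) , ∷-injectiveʳ e
... | inj₁ (_ ∷ t , y≡x𝟘t , e) with refl ← ∷-injectiveˡ e =
  ⊥-elim (balanced-∷ʳ-𝟘-below m x bal-x (nn-y (x ∷ʳ 𝟘) t (trans y≡x𝟘t (sym (∷ʳ-++ x 𝟘 t)))))
... | inj₂ ([] , x≡y , e) = trans x≡y (++-identityʳ y) , sym (∷-injectiveʳ e)
... | inj₂ (_ ∷ t , x≡y𝟘t , e) with refl ← ∷-injectiveˡ e =
  ⊥-elim (balanced-∷ʳ-𝟘-below m y bal-y (nn-x (y ∷ʳ 𝟘) t (trans x≡y𝟘t (sym (∷ʳ-++ y 𝟘 t)))))

splits? : (P : List A → List A → Set) → (∀ p s → Dec (P p s)) →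
  ∀ w → Dec (Σ (List A) λ p → Σ (List A) λ s → w ≡ p ++ s × P p s)
splits? P P? [] with P? [] []
... | yes P[][] = yes ([] , [] , refl , P[][])
... | no ¬P[][] = no λ { ([] , [] , refl , P[][]) → ¬P[][] P[][] }
splits? P P? (c ∷ w) with P? [] (c ∷ w) | splits? (λ p s → P (c ∷ p) s) (λ p s → P? (c ∷ p) s) w
... | yes P[]w | _ = yes ([] , c ∷ w , refl , P[]w)
... | no _ | yes (p , s , w≡ps , Pcps) = yes (c ∷ p , s , cong (c ∷_) w≡ps , Pcps)
... | no ¬P[]w | no ¬split = no λ
  { ([] , s , refl , P[]w) → ¬P[]w P[]w
  ; (_ ∷ p , s , eq , Pcps) → case-cons (∷-injective eq) Pcps }
  where
  case-cons : ∀ {c′ p s} → c ≡ c′ × w ≡ p ++ s → P (c′ ∷ p) s → ⊥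
  case-cons (refl , w≡ps) Pcps = ¬split (_ , _ , w≡ps , Pcps)

nonEmpty? : (w : List A) → Dec (w ≢ [])
nonEmpty? [] = no λ []≢[] → []≢[] refl
nonEmpty? (_ ∷ _) = yes λ ()

contact? : ∀ m w → Dec (Contact m w)
contact? m = splits? _ λ p s → nonEmpty? p ×-dec nonEmpty? s ×-dec (zeros p ≟ m * ones p)

record LastPrimeFactor (m : ℕ) (w : Word) : Set where
  field
    front last   : Word
    w≡front++last : w ≡ front ++ last
    front-dyck   : DyckWord m front
    last-prime   : Prime m last

lastPrimeFactor : ∀ m w → DyckWord m w → w ≢ [] → LastPrimeFactor m w
lastPrimeFactor m w = go (suc (length w)) w ≤-refl
  where
  go : ∀ fuel w → length w < fuel → DyckWord m w → w ≢ [] → LastPrimeFactor m w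
  go (suc fuel) w |w|<fuel dyck w≢[] with contact? m w
  ... | no ¬contact = record
    { front = [] ; last = w ; w≡front++last = refl ; front-dyck = dyck-[] m
    ; last-prime = DyckWord⇒IsDyck dyck , w≢[] , ¬contact }
  ... | yes ([] , _ , _ , []≢[] , _) = ⊥-elim ([]≢[] refl)
  ... | yes (c ∷ p , s , refl , _ , s≢[] , bal) with dyck-split m bal dyck
  ... | dyck-cp , dyck-s = record
    { front = (c ∷ p) ++ front ; last = last
    ; w≡front++last = trans (cong ((c ∷ p) ++_) w≡front++last) (sym (++-assoc (c ∷ p) front last))
    ; front-dyck = dyck-++ m dyck-cp front-dyck ; last-prime = last-prime }
    where
    |s|<fuel : length s < fuel
    |s|<fuel = ≤-trans (s≤s (length-++-≤ʳ s {p})) (s≤s⁻¹ |w|<fuel)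
    open LastPrimeFactor (go fuel s |s|<fuel dyck-s s≢[])

lastPrimeFactor-unique : ∀ m → x ++ y ≡ a ++ b → Balanced m x → Balanced m a → Prime m y → Prime m b →
  x ≡ a × y ≡ b
lastPrimeFactor-unique {x} {y} {a} {b} m eq bal-x bal-a (_ , y≢[] , ¬contact-y) (_ , b≢[] , ¬contact-b)
  with ++-split x y a b eq
... | inj₁ ([] , a≡x , y≡b) = sym (trans a≡x (++-identityʳ x)) , y≡b
... | inj₁ (c ∷ t , a≡xct , y≡ctb) = ⊥-elim (¬contact-y (c ∷ t , b , y≡ctb , (λ ()) , b≢[] ,
        balanced-cancelˡ m x (c ∷ t) bal-x (subst (Balanced m) a≡xct bal-a)))
... | inj₂ ([] , x≡a , b≡y) = trans x≡a (++-identityʳ a) , sym b≡y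
... | inj₂ (c ∷ t , x≡act , b≡cty) = ⊥-elim (¬contact-b (c ∷ t , y , b≡cty , (λ ()) , y≢[] ,
        balanced-cancelˡ m a (c ∷ t) bal-a (subst (Balanced m) x≡act bal-x)))

joinZ-injective : ∀ m {k} (xs ys : Vec Word (suc k)) →
  (∀ i → DyckWord m (lookup xs i)) → (∀ i → DyckWord m (lookup ys i)) → joinZ xs ≡ joinZ ys → xs ≡ ys
joinZ-injective m (x ∷ []) (y ∷ []) _ _ eq = cong (_∷ []) eq
joinZ-injective m (x ∷ x′ ∷ xs) (y ∷ y′ ∷ ys) dyck-xs dyck-ys eq
  with refl , eq′ ← dyck-𝟘-cancel m (dyck-xs zero) (dyck-ys zero) eq =
  cong (x ∷_) (joinZ-injective m (x′ ∷ xs) (y′ ∷ ys) (λ i → dyck-xs (suc i)) (λ i → dyck-ys (suc i)) eq′)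

EmptyAfter : ∀ {k} → Fin k → Vec Word k → Set
EmptyAfter j xs = ∀ i → toℕ j < toℕ i → lookup xs i ≡ []

joinZ-upTo : ∀ {k} → Vec Word (suc k) → Fin (suc k) → Word
joinZ-upTo (x ∷ _) zero = x
joinZ-upTo {suc _} (x ∷ xs) (suc j) = x ++ 𝟘 ∷ joinZ-upTo xs j

joinZ-∷ : ∀ {k} x (xs : Vec Word (suc k)) → joinZ (x ∷ xs) ≡ x ++ 𝟘 ∷ joinZ xs
joinZ-∷ x (_ ∷ _) = refl

joinZ-emptyTail : ∀ {k} x (xs : Vec Word k) → (∀ i → lookup xs i ≡ []) → joinZ (x ∷ xs) ≡ x ++ replicate k 𝟘
joinZ-emptyTail x [] _ = sym (++-identityʳ x)
joinZ-emptyTail x (x′ ∷ xs) empty = cong (λ z → x ++ 𝟘 ∷ z)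
  (trans (joinZ-emptyTail x′ xs (λ i → empty (suc i))) (cong (_++ replicate _ 𝟘) (empty zero)))

joinZ-appendAt : ∀ {k} (xs : Vec Word (suc k)) j w → EmptyAfter j xs →
  joinZ (xs [ j ]≔ (lookup xs j ++ w)) ≡ joinZ-upTo xs j ++ w ++ replicate (k ∸ toℕ j) 𝟘
joinZ-appendAt (x ∷ xs) zero w empty =
  trans (joinZ-emptyTail (x ++ w) xs (λ i → empty (suc i) (s≤s z≤n))) (++-assoc x w _)
joinZ-appendAt {suc _} (x ∷ xs) (suc j) w empty = begin
  joinZ (x ∷ (xs [ j ]≔ (lookup xs j ++ w)))        ≡⟨ joinZ-∷ x (xs [ j ]≔ (lookup xs j ++ w)) ⟩
  x ++ 𝟘 ∷ joinZ (xs [ j ]≔ (lookup xs j ++ w))     ≡⟨ cong (λ z → x ++ 𝟘 ∷ z) (joinZ-appendAt xs j w empty-xs) ⟩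
  x ++ 𝟘 ∷ joinZ-upTo xs j ++ w ++ replicate _ 𝟘    ≡⟨ ++-assoc x (𝟘 ∷ joinZ-upTo xs j) _ ⟨
  (x ++ 𝟘 ∷ joinZ-upTo xs j) ++ w ++ replicate _ 𝟘  ∎
  where
  empty-xs : EmptyAfter j xs
  empty-xs i j<i = empty (suc i) (s≤s j<i)

downSteps-no-𝟙 : ∀ w t r → All (_≡ 𝟘) w → w ≢ t ++ 𝟙 ∷ r
downSteps-no-𝟙 w t r all-𝟘 refl with () ∷ _ ← All.++⁻ʳ t all-𝟘

peak-rightmost : ∀ m a r a′ b′ → a ++ peak m ++ replicate r 𝟘 ≡ a′ ++ peak m ++ b′ → length a′ ≤ length a
peak-rightmost m a r a′ b′ eq with ++-split a _ a′ _ eq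
... | inj₁ ([] , a′≡a , _) = ≤-reflexive (cong length (trans a′≡a (++-identityʳ a)))
... | inj₁ (_ ∷ t , _ , e) = ⊥-elim (downSteps-no-𝟙 (replicate m 𝟘 ++ replicate r 𝟘) t (replicate m 𝟘 ++ b′)
        (All.++⁺ (All.replicate⁺ m refl) (All.replicate⁺ r refl)) (∷-injectiveʳ e))
... | inj₂ (t , a≡a′t , _) =
  ≤-trans (m≤m+n (length a′) (length t)) (≤-reflexive (sym (trans (cong length a≡a′t) (length-++ a′))))

rightmost-peak-unique : ∀ m {w a b a′} r →
  w ≡ a ++ peak m ++ b → (∀ a″ b″ → w ≡ a″ ++ peak m ++ b″ → length a″ ≤ length a) →
  w ≡ a′ ++ peak m ++ replicate r 𝟘 → a ≡ a′ × b ≡ replicate r 𝟘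
rightmost-peak-unique m {w} {a} {b} {a′} r w≡apb rightmost w≡a′pr
  with a≡a′ , pb≡pr ← ++-cancel-equalLength a a′ _ _ (trans (sym w≡apb) w≡a′pr)
         (≤-antisym (peak-rightmost m a′ r a b (trans (sym w≡a′pr) w≡apb)) (rightmost a′ _ w≡a′pr))
  = a≡a′ , ++-cancelˡ (peak m) b (replicate r 𝟘) pb≡pr

D-appendAt : ∀ {m} (us : Vec Word (suc m)) j w → EmptyAfter j us →
  D (us [ j ]≔ (lookup us j ++ w)) ≡ (𝟙 ∷ joinZ-upTo us j) ++ w ++ replicate (m ∸ toℕ j) 𝟘
D-appendAt us j w empty = cong (𝟙 ∷_) (joinZ-appendAt us j w empty)

StarFactorisation : ∀ m → Fin (suc m) → Vec Word (suc m) → Word × Word → Set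
StarFactorisation m j vs (v′ , v″) =
  Star m v′ v″ (D vs) × Prime m v″ ×
  (Σ (Vec Word (suc m)) λ us →
    (∀ i → IsDyck m (lookup us i)) × EmptyAfter j us × v′ ≡ D (us [ j ]≔ (lookup us j ++ peak m)))

module Factorisation {m} (j : Fin (suc m)) (vs : Vec Word (suc m))
  (vs-dyck : ∀ i → IsDyck m (lookup vs i)) (vs-empty : EmptyAfter j vs) (vⱼ≢[] : lookup vs j ≢ [])
  where

  open LastPrimeFactor (lastPrimeFactor m (lookup vs j) (IsDyck⇒DyckWord (vs-dyck j)) vⱼ≢[])

  us₀ : Vec Word (suc m)
  us₀ = vs [ j ]≔ front

  us₀-dyck : ∀ i → IsDyck m (lookup us₀ i)
  us₀-dyck = update-preserves (IsDyck m) vs j front vs-dyck (DyckWord⇒IsDyck front-dyck)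

  us₀-empty : EmptyAfter j us₀
  us₀-empty i j<i =
    trans (lookup∘update′ (λ i≡j → <-irrefl (cong toℕ (sym i≡j)) j<i) vs front) (vs-empty i j<i)

  vs≡us₀-last : vs ≡ us₀ [ j ]≔ (lookup us₀ j ++ last)
  vs≡us₀-last = begin
    vs                                ≡⟨ []≔-lookup vs j ⟨
    vs [ j ]≔ lookup vs j             ≡⟨ cong (vs [ j ]≔_) w≡front++last ⟩
    vs [ j ]≔ (front ++ last)         ≡⟨ []≔-append vs j front last ⟨
    us₀ [ j ]≔ (lookup us₀ j ++ last) ∎

  canonical : Word × Word
  canonical = D (us₀ [ j ]≔ (lookup us₀ j ++ peak m)) , last

  canonical-factorisation : StarFactorisation m j vs canonical
  canonical-factorisation =
    ((λ ()) , proj₁ (proj₂ last-prime) , 𝟙 ∷ joinZ-upTo us₀ j , replicate (m ∸ toℕ j) 𝟘 ,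
     v′≡apb , trans (cong D vs≡us₀-last) (D-appendAt us₀ j last us₀-empty) ,
     λ a′ b′ v′≡a′pb′ → peak-rightmost m _ _ a′ b′ (trans (sym v′≡apb) v′≡a′pb′)) ,
    last-prime , us₀ , us₀-dyck , us₀-empty , refl
    where
    v′≡apb : proj₁ canonical ≡ (𝟙 ∷ joinZ-upTo us₀ j) ++ peak m ++ replicate (m ∸ toℕ j) 𝟘
    v′≡apb = D-appendAt us₀ j (peak m) us₀-empty

  canonical-unique : ∀ {v} → StarFactorisation m j vs v → canonical ≡ v
  canonical-unique {v′ , v″}
    ((_ , _ , a , b , v′≡apb , vs≡av″b , rightmost) , v″-prime , us , us-dyck , us-empty , v′≡Dus) =
    cong₂ _,_ (sym v′≡canonical) (proj₂ factors-match)
    where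
    peak-position : a ≡ 𝟙 ∷ joinZ-upTo us j × b ≡ replicate (m ∸ toℕ j) 𝟘
    peak-position = rightmost-peak-unique m (m ∸ toℕ j) v′≡apb rightmost
      (trans v′≡Dus (D-appendAt us j (peak m) us-empty))

    us-dyckWord : ∀ i → DyckWord m (lookup us i)
    us-dyckWord i = IsDyck⇒DyckWord (us-dyck i)

    vs≡us-v″ : vs ≡ us [ j ]≔ (lookup us j ++ v″)
    vs≡us-v″ = joinZ-injective m vs _ (λ i → IsDyck⇒DyckWord (vs-dyck i))
      (update-preserves (DyckWord m) us j _ us-dyckWord
        (dyck-++ m (us-dyckWord j) (IsDyck⇒DyckWord (proj₁ v″-prime))))
      (∷-injectiveʳ (begin
        D vs                                          ≡⟨ vs≡av″b ⟩
        a ++ v″ ++ b                                  ≡⟨ cong₂ (λ a b → a ++ v″ ++ b) (proj₁ peak-position) (proj₂ peak-position) ⟩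
        (𝟙 ∷ joinZ-upTo us j) ++ v″ ++ replicate _ 𝟘  ≡⟨ D-appendAt us j v″ us-empty ⟨
        D (us [ j ]≔ (lookup us j ++ v″))             ∎))

    factors-match : front ≡ lookup us j × last ≡ v″
    factors-match = lastPrimeFactor-unique m
      (trans (sym w≡front++last) (trans (cong (λ z → lookup z j) vs≡us-v″) (lookup∘update j us _)))
      (proj₁ front-dyck) (proj₁ (us-dyckWord j)) last-prime v″-prime

    v′≡canonical : v′ ≡ proj₁ canonical
    v′≡canonical = begin
      v′                                         ≡⟨ v′≡Dus ⟩
      D (us [ j ]≔ (lookup us j ++ peak m))      ≡⟨ cong (λ z → D (us [ j ]≔ (z ++ peak m))) (proj₁ factors-match) ⟨
      D (us [ j ]≔ (front ++ peak m))            ≡⟨ cong D ([]≔-idempotent us j) ⟨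
      D ((us [ j ]≔ _) [ j ]≔ (front ++ peak m)) ≡⟨ cong (λ u → D (u [ j ]≔ (front ++ peak m))) vs≡us-v″ ⟨
      D (vs [ j ]≔ (front ++ peak m))            ≡⟨ cong D ([]≔-append vs j front (peak m)) ⟨
      D (us₀ [ j ]≔ (lookup us₀ j ++ peak m))    ∎

lemma5p1 : (m n : ℕ) → 1 ≤ m → (j : Fin (suc m)) → (vs : Vec Word (suc m)) →
    (∀ i → IsDyck m (lookup vs i)) →
    (∀ i → toℕ j < toℕ i → lookup vs i ≡ []) →
    ¬ (lookup vs j ≡ []) →
    Dyck m n (D vs) →
    ∃! _≡_ (λ (p : Word × Word) →
      Star m (proj₁ p) (proj₂ p) (D vs) × Prime m (proj₂ p) ×
      (Σ (Vec Word (suc m)) λ us →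
        (∀ i → IsDyck m (lookup us i)) ×
        (∀ i → toℕ j < toℕ i → lookup us i ≡ []) ×
        proj₁ p ≡ D (us [ j ]≔ (lookup us j ++ peak m))))
lemma5p1 m n _ j vs vs-dyck vs-empty vⱼ≢[] _ = canonical , canonical-factorisation , canonical-unique
  where open Factorisation j vs vs-dyck vs-empty vⱼ≢[]
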